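{- Let $X=\{x_1,\dots,x_n\}$ be positive integers with $\sum_{i=1}^n x_i=2B$, and let $I$ be the instance of $(1 \mid p\mathrm{MA} \mid \sum_j C_j)$ constructed from $X$ as described in the context. If there is a subset $X_1\subset X$ with $\sum_{x\in X_1}x=B$, then there is a feasible schedule for $I$ with total completion time at most $Q=Q_0+B$.
   Context: Problem $(1 \mid p\mathrm{MA} \mid \sum_j C_j)$: a single machine with maintenance level initially $\mathrm{ML}_0$ and maximum $\mathrm{ML}^{\max}$; each job $J_i$ has non-preemptive processing time $p_i$ and deterioration $\delta_i$, and processing it decreases the level by $\delta_i$; the level must never be negative; maintenance activities (MAs) of any duration $D\in[0,\mathrm{ML}^{\max}-\mathrm{ML}]$ ($\mathrm{ML}$ the current level) may be inserted, occupying the machine for time $D$ and raising the level by $D$. The objective is the total completion time $\sum_i C_i$. Construction of $I$ from $X$: there are $2n+3$ jobs $J_0,\dots,J_{2n+2}$. Fix an integer $M>(4n+8)B$. For $i=0,1,\dots,n$: $p_i=p_{n+1+i}=\sum_{j=1}^i x_j$ (so $p_0=0$) and $\delta_i=\delta_{n+1+i}=M-2p_i$. Also $p_{2n+2}=M-2B$, $\delta_{2n+2}=0$. The initial maintenance level is $\mathrm{ML}_0=\sum_{i=0}^n\delta_i-2B$ and the maximum maintenance level is $\mathrm{ML}^{\max}=\sum_{i=0}^n\delta_i$. Define $$Q_0=\sum_{j=0}^n(n-j+1)p_j+(n+2)\Big(\sum_{j=0}^np_j+2B+p_{2n+2}\Big)+\sum_{j=0}^n(j+1)(p_{n+1+j}+\delta_{n+1+j}),$$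 and $Q=Q_0+B$. -}

module Defs where

open import Data.Nat using (ℕ; zero; suc; _+_; _*_; _∸_; _≤_; _<_; _≤ᵇ_)
open import Data.Bool using (Bool; true; false; if_then_else_)
open import Data.Fin using (Fin; toℕ)
open import Data.Fin.Properties using (_≟_)
open import Data.List using (List; []; _∷_; take; length)
open import Data.Nat.ListAction using (sum)
open import Data.Product using (_×_)
open import Data.Unit using (⊤)
open import Relation.Nullary using (yes; no)
open import Relation.Binary.PropositionalEquality using (_≡_)

record Instance : Set where
  field
    m     : ℕ
    p     : Fin m → ℕ
    δ     : Fin m → ℕ
    ML₀   : ℕ
    MLmax : ℕ

-- A schedule is the sequence of activities on the machine, processed
-- back to back from time 0: either a job or a maintenance activity of
-- duration D.
data Item (m : ℕ) : Set where
  job : Fin m → Item m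
  ma  : ℕ → Item m

Schedule : ℕ → Set
Schedule m = List (Item m)

module _ (I : Instance) where
  open Instance I

  occ : Fin m → Schedule m → ℕ
  occ j []           = 0
  occ j (job k ∷ s) with j ≟ k
  ... | yes _ = suc (occ j s)
  ... | no  _ = occ j s
  occ j (ma _ ∷ s)   = occ j s

  LevelOK : ℕ → Schedule m → Set
  LevelOK L []           = ⊤
  LevelOK L (job j ∷ s)  = (δ j ≤ L) × LevelOK (L ∸ δ j) s
  LevelOK L (ma D ∷ s)   = (L + D ≤ MLmax) × LevelOK (L + D) s

  Feasible : Schedule m → Set
  Feasible s = ((j : Fin m) → occ j s ≡ 1) × LevelOK ML₀ s

  tct : ℕ → Schedule m → ℕ
  tct t []           = 0
  tct t (job j ∷ s)  = (t + p j) + tct (t + p j) s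
  tct t (ma D ∷ s)   = tct (t + D) s

  TotalCompletionTime : Schedule m → ℕ
  TotalCompletionTime = tct 0

sumTo : ℕ → (ℕ → ℕ) → ℕ
sumTo zero    f = f 0
sumTo (suc k) f = sumTo k f + f (suc k)

module Construction (xs : List ℕ) (B M : ℕ) where
  n : ℕ
  n = length xs

  P : ℕ → ℕ
  P i = sum (take i xs)

  pN : ℕ → ℕ
  pN k = if k ≤ᵇ n then P k
         else if k ≤ᵇ 2 * n + 1 then P (k ∸ (n + 1))
         else M ∸ 2 * B

  δN : ℕ → ℕ
  δN k = if k ≤ᵇ 2 * n + 1 then M ∸ 2 * pN k else 0

  MLmax : ℕ
  MLmax = sumTo n δN

  ML₀ : ℕ
  ML₀ = MLmax ∸ 2 * B

  inst : Instance
  inst = record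
    { m     = 2 * n + 3
    ; p     = λ k → pN (toℕ k)
    ; δ     = λ k → δN (toℕ k)
    ; ML₀   = ML₀
    ; MLmax = MLmax
    }

  Q₀ : ℕ
  Q₀ = sumTo n (λ j → (n ∸ j + 1) * pN j)
     + (n + 2) * (sumTo n pN + 2 * B + pN (2 * n + 2))
     + sumTo n (λ j → (j + 1) * (pN (n + 1 + j) + δN (n + 1 + j)))

  Q : ℕ
  Q = Q₀ + B

module Submission where

-- For k ≤ n the jobs J_k and J_{n+1+k} both have processing time P k = x_1 + … + x_k and
-- deterioration M − 2 P k. From X₁ build the schedule: first, for k = 0, …, n, the job J_k,
-- replaced by J_{n+2+k} (processing time P k + x_{k+1}) when x_{k+1} ∈ X₁; then J_{2n+2};
-- then the remaining n + 1 jobs by decreasing index, each preceded by a maintenance activity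
-- restoring exactly its deterioration. Each replacement saves 2 x_{k+1} of level, so the first
-- phase consumes exactly Σ δ_i − 2B = ML₀ and J_{2n+2} (with δ = 0) starts at level 0. Every
-- job occurs once because the replacement is an involution on job indices. The cost is exactly
-- Q: the selected amounts occur once in each phase, in opposite orders, and since
-- totalCompletion l + totalCompletion (reverse l) = (|l| + 1) Σ l they add (n + 3) B, whereas
-- J_{2n+2} completes B earlier than Q₀ accounts for, which saves (n + 2) B.

open import Defs
open import Data.Bool using (Bool; true; false; if_then_else_)
open import Data.Fin using (Fin; toℕ)
open import Data.Fin.Properties using (toℕ-fromℕ<; toℕ-injective; toℕ<n) renaming (_≟_ to _≟ᶠ_)
open import Data.List using (List; []; _∷_; _++_; _∷ʳ_; map; length; reverse; take; applyUpTo; applyDownFrom; upTo; downFrom)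
open import Data.List.Properties using (applyUpTo-∷ʳ; applyDownFrom-∷ʳ; reverse-applyUpTo; map-upTo; map-applyUpTo; length-applyDownFrom)
open import Data.List.Relation.Binary.Permutation.Propositional.Properties using (↭-reverse)
open import Data.List.Relation.Binary.Sublist.Heterogeneous as Sublist using ()
open import Data.List.Relation.Binary.Sublist.Propositional using (_⊆_)
open import Data.List.Relation.Unary.All using (All)
open import Data.Nat using (ℕ; zero; suc; _+_; _*_; _∸_; _<_; _≤_; _≡ᵇ_; _≤ᵇ_; _≟_; _≤?_; z≤n; s≤s; z<s; NonZero; >-nonZero)
open import Data.Nat.DivMod using (_mod_; m<n⇒m%n≡m)
open import Data.Nat.ListAction using (sum)
open import Data.Nat.ListAction.Properties using (sum-++; sum-↭)
open import Data.Nat.Properties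
open import Algebra.Properties.CommutativeSemigroup +-commutativeSemigroup using () renaming (interchange to +-interchange)
open import Data.Nat.Tactic.RingSolver using (solve-∀)
open import Data.Product using (Σ; _×_; _,_)
open import Data.Sum using (inj₁; inj₂)
open import Data.Unit using (tt)
open import Function using (_∘_; id)
open import Relation.Nullary using (yes; no; ¬_; contradiction)
open import Relation.Binary.PropositionalEquality using (_≡_; _≢_; refl; sym; trans; cong; cong₂; subst; module ≡-Reasoning)

private
  variable
    A : Set
    a b c i j k t u : ℕ
    f g : ℕ → ℕ

if-≤ᵇ-true : ∀ {x y : A} → a ≤ b → (if a ≤ᵇ b then x else y) ≡ x
if-≤ᵇ-true {a = a} {b} a≤b with a ≤ᵇ b | ≤⇒≤ᵇ a≤b
... | true | _ = refl

if-≤ᵇ-false : ∀ {x y : A} → b < a → (if a ≤ᵇ b then x else y) ≡ y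
if-≤ᵇ-false {b = b} {a} b<a with a ≤ᵇ b | ≤ᵇ⇒≤ a b
... | true  | a≤b = contradiction (a≤b tt) (<⇒≱ b<a)
... | false | _   = refl

∸-+-cancelʳ : ∀ b c → b + c ≤ a → (a ∸ (b + c)) + c ≡ a ∸ b
∸-+-cancelʳ {a} b c b+c≤a = begin
  (a ∸ (b + c)) + c  ≡⟨ cong (_+ c) (∸-+-assoc a b c) ⟨
  (a ∸ b ∸ c) + c    ≡⟨ m∸n+n≡m (m+n≤o⇒m≤o∸n c (subst (_≤ a) (+-comm b c) b+c≤a)) ⟩
  a ∸ b              ∎
  where open ≡-Reasoning

applyUpTo-cong : (∀ {k} → k < c → f k ≡ g k) → applyUpTo f c ≡ applyUpTo g c
applyUpTo-cong {zero}  eq = refl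
applyUpTo-cong {suc c} eq = cong₂ _∷_ (eq (s≤s z≤n)) (applyUpTo-cong (eq ∘ s≤s))

applyDownFrom-cong : (∀ {k} → k < c → f k ≡ g k) → applyDownFrom f c ≡ applyDownFrom g c
applyDownFrom-cong {zero}  eq = refl
applyDownFrom-cong {suc c} eq = cong₂ _∷_ (eq ≤-refl) (applyDownFrom-cong (eq ∘ m≤n⇒m≤1+n))

map-applyDownFrom : ∀ (f : ℕ → A) (g : A → ℕ) c → map g (applyDownFrom f c) ≡ applyDownFrom (g ∘ f) c
map-applyDownFrom f g zero    = refl
map-applyDownFrom f g (suc c) = cong (g (f c) ∷_) (map-applyDownFrom f g c)

sum-applyUpTo-+ : ∀ a b → sum (applyUpTo f (a + b)) ≡ sum (applyUpTo f a) + sum (applyUpTo (λ k → f (a + k)) b)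
sum-applyUpTo-+ zero    b = refl
sum-applyUpTo-+ {f} (suc a) b = trans (cong (f 0 +_) (sum-applyUpTo-+ {f ∘ suc} a b)) (sym (+-assoc (f 0) _ _))

sum-applyUpTo-∷ʳ : ∀ c → sum (applyUpTo f (suc c)) ≡ sum (applyUpTo f c) + f c
sum-applyUpTo-∷ʳ {f} c = begin
  sum (applyUpTo f (suc c))           ≡⟨ cong sum (applyUpTo-∷ʳ f c) ⟨
  sum (applyUpTo f c ++ f c ∷ [])     ≡⟨ sum-++ (applyUpTo f c) (f c ∷ []) ⟩
  sum (applyUpTo f c) + (f c + 0)     ≡⟨ cong (sum (applyUpTo f c) +_) (+-identityʳ (f c)) ⟩
  sum (applyUpTo f c) + f c           ∎
  where open ≡-Reasoning

sum-applyUpTo-pointwise : ∀ (f g : ℕ → ℕ) c → sum (applyUpTo (λ k → f k + g k) c) ≡ sum (applyUpTo f c) + sum (applyUpTo g c)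
sum-applyUpTo-pointwise f g zero    = refl
sum-applyUpTo-pointwise f g (suc c) =
  trans (cong (f 0 + g 0 +_) (sum-applyUpTo-pointwise (f ∘ suc) (g ∘ suc) c)) (+-interchange (f 0) (g 0) _ _)

sum-applyDownFrom : ∀ c → sum (applyDownFrom f c) ≡ sum (applyUpTo f c)
sum-applyDownFrom {f} c = begin
  sum (applyDownFrom f c)        ≡⟨ cong sum (reverse-applyUpTo f c) ⟨
  sum (reverse (applyUpTo f c))  ≡⟨ sum-↭ (↭-reverse (applyUpTo f c)) ⟩
  sum (applyUpTo f c)            ∎
  where open ≡-Reasoning

sumTo-applyUpTo : ∀ c f → sumTo c f ≡ sum (applyUpTo f (suc c))
sumTo-applyUpTo zero    f = sym (+-identityʳ (f 0))
sumTo-applyUpTo (suc c) f = trans (cong (_+ f (suc c)) (sumTo-applyUpTo c f)) (sym (sum-applyUpTo-∷ʳ {f} (suc c)))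

sumTo-pointwise : ∀ c (f g : ℕ → ℕ) → sumTo c (λ j → f j + g j) ≡ sumTo c f + sumTo c g
sumTo-pointwise zero    f g = refl
sumTo-pointwise (suc c) f g = trans (cong (_+ (f (suc c) + g (suc c))) (sumTo-pointwise c f g)) (+-interchange (sumTo c f) (sumTo c g) (f (suc c)) (g (suc c)))

sumTo-cong : ∀ c → (∀ {j} → j ≤ c → f j ≡ g j) → sumTo c f ≡ sumTo c g
sumTo-cong zero    eq = eq z≤n
sumTo-cong (suc c) eq = cong₂ _+_ (sumTo-cong c (eq ∘ m≤n⇒m≤1+n)) (eq ≤-refl)

sumTo-≥-first : ∀ c (f : ℕ → ℕ) → f 0 ≤ sumTo c f
sumTo-≥-first zero    f = ≤-refl
sumTo-≥-first (suc c) f = ≤-trans (sumTo-≥-first c f) (m≤m+n _ (f (suc c)))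

-- Completion-time sums

totalCompletion : ℕ → List ℕ → ℕ
totalCompletion t []       = 0
totalCompletion t (v ∷ vs) = (t + v) + totalCompletion (t + v) vs

totalCompletion-shift : ∀ t vs → totalCompletion t vs ≡ length vs * t + totalCompletion 0 vs
totalCompletion-shift t []       = refl
totalCompletion-shift t (v ∷ vs) = begin
  (t + v) + totalCompletion (t + v) vs                  ≡⟨ cong ((t + v) +_) (totalCompletion-shift (t + v) vs) ⟩
  (t + v) + (length vs * (t + v) + totalCompletion 0 vs) ≡⟨ regroup t v (length vs) (totalCompletion 0 vs) ⟩
  (t + length vs * t) + (v + (length vs * v + totalCompletion 0 vs))
    ≡⟨ cong (λ r → (t + length vs * t) + (v + r)) (totalCompletion-shift v vs) ⟨
  (t + length vs * t) + (v + totalCompletion v vs)       ∎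
  where
  open ≡-Reasoning
  regroup : ∀ t v l c → (t + v) + (l * (t + v) + c) ≡ (t + l * t) + (v + (l * v + c))
  regroup = solve-∀

totalCompletion-map-+ : ∀ (f g : A → ℕ) t u as →
  totalCompletion (t + u) (map (λ a → f a + g a) as) ≡ totalCompletion t (map f as) + totalCompletion u (map g as)
totalCompletion-map-+ f g t u []       = refl
totalCompletion-map-+ f g t u (a ∷ as) = begin
  (t + u + (f a + g a)) + totalCompletion (t + u + (f a + g a)) (map (λ a → f a + g a) as)
    ≡⟨ cong (λ s → (t + u + (f a + g a)) + totalCompletion s (map (λ a → f a + g a) as)) (+-interchange t u (f a) (g a)) ⟩
  (t + u + (f a + g a)) + totalCompletion ((t + f a) + (u + g a)) (map (λ a → f a + g a) as)
    ≡⟨ cong ((t + u + (f a + g a)) +_) (totalCompletion-map-+ f g (t + f a) (u + g a) as) ⟩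
  (t + u + (f a + g a)) + (totalCompletion (t + f a) (map f as) + totalCompletion (u + g a) (map g as))
    ≡⟨ regroup t u (f a) (g a) _ _ ⟩
  ((t + f a) + totalCompletion (t + f a) (map f as)) + ((u + g a) + totalCompletion (u + g a) (map g as)) ∎
  where
  open ≡-Reasoning
  regroup : ∀ t u a b x y → (t + u + (a + b)) + (x + y) ≡ ((t + a) + x) + ((u + b) + y)
  regroup = solve-∀

totalCompletion-applyUpTo-+ : ∀ c →
  totalCompletion (t + u) (applyUpTo (λ k → f k + g k) c) ≡ totalCompletion t (applyUpTo f c) + totalCompletion u (applyUpTo g c)
totalCompletion-applyUpTo-+ {t} {u} {f} {g} c = begin
  totalCompletion (t + u) (applyUpTo (λ k → f k + g k) c)         ≡⟨ cong (totalCompletion (t + u)) (map-upTo (λ k → f k + g k) c) ⟨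
  totalCompletion (t + u) (map (λ k → f k + g k) (upTo c))        ≡⟨ totalCompletion-map-+ f g t u (upTo c) ⟩
  totalCompletion t (map f (upTo c)) + totalCompletion u (map g (upTo c))
    ≡⟨ cong₂ _+_ (cong (totalCompletion t) (map-upTo f c)) (cong (totalCompletion u) (map-upTo g c)) ⟩
  totalCompletion t (applyUpTo f c) + totalCompletion u (applyUpTo g c) ∎
  where open ≡-Reasoning

totalCompletion-applyDownFrom-+ : ∀ c →
  totalCompletion (t + u) (applyDownFrom (λ k → f k + g k) c) ≡ totalCompletion t (applyDownFrom f c) + totalCompletion u (applyDownFrom g c)
totalCompletion-applyDownFrom-+ {t} {u} {f} {g} c = begin
  totalCompletion (t + u) (applyDownFrom (λ k → f k + g k) c)     ≡⟨ cong (totalCompletion (t + u)) (map-applyDownFrom id (λ k → f k + g k) c) ⟨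
  totalCompletion (t + u) (map (λ k → f k + g k) (downFrom c))    ≡⟨ totalCompletion-map-+ f g t u (downFrom c) ⟩
  totalCompletion t (map f (downFrom c)) + totalCompletion u (map g (downFrom c))
    ≡⟨ cong₂ _+_ (cong (totalCompletion t) (map-applyDownFrom id f c)) (cong (totalCompletion u) (map-applyDownFrom id g c)) ⟩
  totalCompletion t (applyDownFrom f c) + totalCompletion u (applyDownFrom g c) ∎
  where open ≡-Reasoning

totalCompletion-∷ʳ : ∀ t vs v → totalCompletion t (vs ∷ʳ v) ≡ totalCompletion t vs + (t + sum vs + v)
totalCompletion-∷ʳ t []       v = trans (+-identityʳ (t + v)) (cong (_+ v) (sym (+-identityʳ t)))
totalCompletion-∷ʳ t (w ∷ vs) v = begin
  (t + w) + totalCompletion (t + w) (vs ∷ʳ v)                     ≡⟨ cong ((t + w) +_) (totalCompletion-∷ʳ (t + w) vs v) ⟩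
  (t + w) + (totalCompletion (t + w) vs + (t + w + sum vs + v))   ≡⟨ regroup t w (totalCompletion (t + w) vs) (sum vs) v ⟩
  ((t + w) + totalCompletion (t + w) vs) + (t + (w + sum vs) + v) ∎
  where
  open ≡-Reasoning
  regroup : ∀ t w c s v → (t + w) + (c + (t + w + s + v)) ≡ ((t + w) + c) + (t + (w + s) + v)
  regroup = solve-∀

totalCompletion-applyUpTo : ∀ c f → totalCompletion 0 (applyUpTo f (suc c)) ≡ sumTo c (λ j → (c ∸ j + 1) * f j)
totalCompletion-applyUpTo zero    f = refl
totalCompletion-applyUpTo (suc c) f = begin
  totalCompletion 0 (applyUpTo f (2 + c))                              ≡⟨ cong (totalCompletion 0) (applyUpTo-∷ʳ f (suc c)) ⟨
  totalCompletion 0 (applyUpTo f (suc c) ∷ʳ f (suc c))                 ≡⟨ totalCompletion-∷ʳ 0 (applyUpTo f (suc c)) (f (suc c)) ⟩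
  totalCompletion 0 (applyUpTo f (suc c)) + (sum (applyUpTo f (suc c)) + f (suc c))
    ≡⟨ cong₂ (λ a s → a + (s + f (suc c))) (totalCompletion-applyUpTo c f) (sym (sumTo-applyUpTo c f)) ⟩
  sumTo c (λ j → (c ∸ j + 1) * f j) + (sumTo c f + f (suc c))          ≡⟨ +-assoc _ (sumTo c f) (f (suc c)) ⟨
  sumTo c (λ j → (c ∸ j + 1) * f j) + sumTo c f + f (suc c)            ≡⟨ cong (_+ f (suc c)) (sumTo-pointwise c _ f) ⟨
  sumTo c (λ j → (c ∸ j + 1) * f j + f j) + f (suc c)                  ≡⟨ cong₂ _+_ (sumTo-cong c weight-suc) last ⟩
  sumTo c (λ j → (suc c ∸ j + 1) * f j) + (suc c ∸ suc c + 1) * f (suc c) ∎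
  where
  open ≡-Reasoning
  weight-suc : ∀ {j} → j ≤ c → (c ∸ j + 1) * f j + f j ≡ (suc c ∸ j + 1) * f j
  weight-suc {j} j≤c = begin
    (c ∸ j + 1) * f j + f j   ≡⟨ +-comm _ (f j) ⟩
    (suc (c ∸ j) + 1) * f j   ≡⟨ cong (λ w → (w + 1) * f j) (+-∸-assoc 1 j≤c) ⟨
    (suc c ∸ j + 1) * f j     ∎
  last : f (suc c) ≡ (suc c ∸ suc c + 1) * f (suc c)
  last = trans (sym (*-identityˡ (f (suc c)))) (cong (λ w → (w + 1) * f (suc c)) (sym (n∸n≡0 c)))

totalCompletion-applyDownFrom : ∀ c f → totalCompletion 0 (applyDownFrom f (suc c)) ≡ sumTo c (λ j → (j + 1) * f j)
totalCompletion-applyDownFrom zero    f = refl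
totalCompletion-applyDownFrom (suc c) f = begin
  f (suc c) + totalCompletion (f (suc c)) (applyDownFrom f (suc c))
    ≡⟨ cong (f (suc c) +_) (totalCompletion-shift (f (suc c)) (applyDownFrom f (suc c))) ⟩
  f (suc c) + (length (applyDownFrom f (suc c)) * f (suc c) + totalCompletion 0 (applyDownFrom f (suc c)))
    ≡⟨ cong₂ (λ l r → f (suc c) + (l * f (suc c) + r)) (length-applyDownFrom f (suc c)) (totalCompletion-applyDownFrom c f) ⟩
  f (suc c) + (suc c * f (suc c) + sumTo c (λ j → (j + 1) * f j))
    ≡⟨ regroup (f (suc c)) c (sumTo c (λ j → (j + 1) * f j)) ⟩
  sumTo c (λ j → (j + 1) * f j) + (suc c + 1) * f (suc c) ∎
  where
  open ≡-Reasoning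
  regroup : ∀ x c s → x + ((1 + c) * x + s) ≡ s + ((1 + c) + 1) * x
  regroup = solve-∀

totalCompletion-applyUpTo+applyDownFrom : ∀ c f →
  totalCompletion 0 (applyUpTo f c) + totalCompletion 0 (applyDownFrom f c) ≡ suc c * sum (applyUpTo f c)
totalCompletion-applyUpTo+applyDownFrom zero    f = refl
totalCompletion-applyUpTo+applyDownFrom (suc c) f = begin
  totalCompletion 0 (applyUpTo f (suc c)) + (f c + totalCompletion (f c) (applyDownFrom f c))
    ≡⟨ cong₂ _+_ upward downward ⟩
  (U + (S + f c)) + (f c + (c * f c + D))
    ≡⟨ regroup U D S (f c) c ⟩
  (U + D) + S + (2 + c) * f c
    ≡⟨ cong (λ s → s + S + (2 + c) * f c) (totalCompletion-applyUpTo+applyDownFrom c f) ⟩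
  suc c * S + S + (2 + c) * f c
    ≡⟨ factor S (f c) c ⟩
  suc (suc c) * (S + f c)
    ≡⟨ cong (suc (suc c) *_) (sum-applyUpTo-∷ʳ {f} c) ⟨
  suc (suc c) * sum (applyUpTo f (suc c)) ∎
  where
  open ≡-Reasoning
  U D S : ℕ
  U = totalCompletion 0 (applyUpTo f c)
  D = totalCompletion 0 (applyDownFrom f c)
  S = sum (applyUpTo f c)
  upward : totalCompletion 0 (applyUpTo f (suc c)) ≡ U + (S + f c)
  upward = trans (cong (totalCompletion 0) (sym (applyUpTo-∷ʳ f c))) (totalCompletion-∷ʳ 0 (applyUpTo f c) (f c))
  downward : f c + totalCompletion (f c) (applyDownFrom f c) ≡ f c + (c * f c + D)
  downward = cong (f c +_) (trans (totalCompletion-shift (f c) (applyDownFrom f c))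
                                  (cong (λ l → l * f c + D) (length-applyDownFrom f c)))
  regroup : ∀ U D S x c → (U + (S + x)) + (x + (c * x + D)) ≡ (U + D) + S + (2 + c) * x
  regroup = solve-∀
  factor : ∀ S x c → suc c * S + S + (2 + c) * x ≡ suc (suc c) * (S + x)
  factor = solve-∀

-- Counting through an involution

indicator : ℕ → ℕ → ℕ
indicator i k = if i ≡ᵇ k then 1 else 0

indicator-refl : ∀ i → indicator i i ≡ 1
indicator-refl zero    = refl
indicator-refl (suc i) = indicator-refl i

indicator-≢ : ∀ i k → i ≢ k → indicator i k ≡ 0
indicator-≢ zero    zero    i≢k = contradiction refl i≢k
indicator-≢ zero    (suc k) i≢k = refl
indicator-≢ (suc i) zero    i≢k = refl
indicator-≢ (suc i) (suc k) i≢k = indicator-≢ i k (i≢k ∘ cong suc)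

sum-applyUpTo-indicator : i < c → sum (applyUpTo (indicator i) c) ≡ 1
sum-applyUpTo-indicator {zero}  {suc c} _         = cong suc (sum-zeros c)
  where
  sum-zeros : ∀ c → sum (applyUpTo (λ _ → 0) c) ≡ 0
  sum-zeros zero    = refl
  sum-zeros (suc c) = sum-zeros c
sum-applyUpTo-indicator {suc i} {suc c} (s≤s i<c) = sum-applyUpTo-indicator i<c

module _ (σ : ℕ → ℕ) (σ-involutive : ∀ k → σ (σ k) ≡ k) where

  indicator-involution : ∀ i k → indicator i (σ k) ≡ indicator (σ i) k
  indicator-involution i k with i ≟ σ k
  ... | yes refl = trans (indicator-refl (σ k)) (sym (subst (λ l → indicator l k ≡ 1) (sym (σ-involutive k)) (indicator-refl k)))
  ... | no i≢σk  = trans (indicator-≢ i (σ k) i≢σk)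
                         (sym (indicator-≢ (σ i) k (λ σi≡k → i≢σk (trans (sym (σ-involutive i)) (cong σ σi≡k)))))

  sum-applyUpTo-indicator-involution : ∀ {c} i → σ i < c → sum (applyUpTo (λ k → indicator i (σ k)) c) ≡ 1
  sum-applyUpTo-indicator-involution {c} i σi<c =
    trans (cong sum (applyUpTo-cong {c} (λ {k} _ → indicator-involution i k))) (sum-applyUpTo-indicator σi<c)

lookupOr : A → List A → ℕ → A
lookupOr d []       k       = d
lookupOr d (x ∷ xs) zero    = x
lookupOr d (x ∷ xs) (suc k) = lookupOr d xs k

sum-take-suc : ∀ (xs : List ℕ) k → sum (take (suc k) xs) ≡ sum (take k xs) + lookupOr 0 xs k
sum-take-suc []       zero    = refl
sum-take-suc []       (suc k) = refl
sum-take-suc (x ∷ xs) zero    = +-identityʳ x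
sum-take-suc (x ∷ xs) (suc k) = trans (cong (x +_) (sum-take-suc xs k)) (sym (+-assoc x _ _))

sum-take-≤ : ∀ (xs : List ℕ) k → sum (take k xs) ≤ sum xs
sum-take-≤ []       zero    = ≤-refl
sum-take-≤ []       (suc k) = ≤-refl
sum-take-≤ (x ∷ xs) zero    = z≤n
sum-take-≤ (x ∷ xs) (suc k) = +-monoʳ-≤ x (sum-take-≤ xs k)

restrictTo : (ℕ → Bool) → (ℕ → ℕ) → ℕ → ℕ
restrictTo chosen f k = if chosen k then f k else 0

-- chosen k says that the entry at position k (x_{k+1} in the paper) belongs to the subset.
record Selection (xs : List ℕ) (B : ℕ) : Set where
  field
    chosen     : ℕ → Bool
    chosen⇒<   : ∀ k → chosen k ≡ true → k < length xs
    sum-chosen : sum (applyUpTo (restrictTo chosen (lookupOr 0 xs)) (length xs)) ≡ B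

sublist-selection : ∀ {X₁ xs} → X₁ ⊆ xs → Selection xs (sum X₁)
sublist-selection Sublist.[] = record
  { chosen = λ _ → false ; chosen⇒< = λ _ () ; sum-chosen = refl }
sublist-selection (y Sublist.∷ʳ X₁⊆xs) = record
  { chosen     = λ { zero → false ; (suc k) → chosen k }
  ; chosen⇒<   = λ { zero () ; (suc k) e → s≤s (chosen⇒< k e) }
  ; sum-chosen = sum-chosen
  }
  where open Selection (sublist-selection X₁⊆xs)
sublist-selection (refl Sublist.∷ X₁⊆xs) = record
  { chosen     = λ { zero → true ; (suc k) → chosen k }
  ; chosen⇒<   = λ { zero _ → s≤s z≤n ; (suc k) e → s≤s (chosen⇒< k e) }
  ; sum-chosen = cong (_ +_) sum-chosen
  }
  where open Selection (sublist-selection X₁⊆xs)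

module _ (I : Instance) where
  open Instance I

  restoring : List (Fin m) → Schedule m
  restoring []       = []
  restoring (y ∷ ys) = ma (δ y) ∷ job y ∷ restoring ys

  occ-job-∷ : ∀ j y s → occ I j (job y ∷ s) ≡ indicator (toℕ j) (toℕ y) + occ I j s
  occ-job-∷ j y s with j ≟ᶠ y
  ... | yes refl = cong (_+ occ I j s) (sym (indicator-refl (toℕ j)))
  ... | no j≢y   = cong (_+ occ I j s) (sym (indicator-≢ (toℕ j) (toℕ y) (j≢y ∘ toℕ-injective)))

  occ-jobs-++ : ∀ j ys s → occ I j (map job ys ++ s) ≡ sum (map (indicator (toℕ j) ∘ toℕ) ys) + occ I j s
  occ-jobs-++ j []       s = refl
  occ-jobs-++ j (y ∷ ys) s = begin
    occ I j (job y ∷ map job ys ++ s)                   ≡⟨ occ-job-∷ j y (map job ys ++ s) ⟩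
    hit y + occ I j (map job ys ++ s)                   ≡⟨ cong (hit y +_) (occ-jobs-++ j ys s) ⟩
    hit y + (sum (map hit ys) + occ I j s)              ≡⟨ +-assoc (hit y) (sum (map hit ys)) (occ I j s) ⟨
    hit y + sum (map hit ys) + occ I j s                ∎
    where
    open ≡-Reasoning
    hit : Fin m → ℕ
    hit = indicator (toℕ j) ∘ toℕ

  occ-restoring : ∀ j ys → occ I j (restoring ys) ≡ sum (map (indicator (toℕ j) ∘ toℕ) ys)
  occ-restoring j []       = refl
  occ-restoring j (y ∷ ys) = trans (occ-job-∷ j y (restoring ys)) (cong (indicator (toℕ j) (toℕ y) +_) (occ-restoring j ys))

  tct-jobs-++ : ∀ t ys s → tct I t (map job ys ++ s) ≡ totalCompletion t (map p ys) + tct I (t + sum (map p ys)) s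
  tct-jobs-++ t []       s = cong (λ t′ → tct I t′ s) (sym (+-identityʳ t))
  tct-jobs-++ t (y ∷ ys) s = begin
    (t + p y) + tct I (t + p y) (map job ys ++ s)
      ≡⟨ cong ((t + p y) +_) (tct-jobs-++ (t + p y) ys s) ⟩
    (t + p y) + (totalCompletion (t + p y) (map p ys) + tct I (t + p y + sum (map p ys)) s)
      ≡⟨ +-assoc (t + p y) _ _ ⟨
    (t + p y) + totalCompletion (t + p y) (map p ys) + tct I (t + p y + sum (map p ys)) s
      ≡⟨ cong (λ t′ → (t + p y) + totalCompletion (t + p y) (map p ys) + tct I t′ s) (+-assoc t (p y) _) ⟩
    (t + p y) + totalCompletion (t + p y) (map p ys) + tct I (t + (p y + sum (map p ys))) s ∎
    where open ≡-Reasoning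

  tct-restoring : ∀ t ys → tct I t (restoring ys) ≡ totalCompletion t (map (λ y → δ y + p y) ys)
  tct-restoring t []       = refl
  tct-restoring t (y ∷ ys) rewrite +-assoc t (δ y) (p y) = cong ((t + (δ y + p y)) +_) (tct-restoring (t + (δ y + p y)) ys)

  levelOK-jobs-++ : ∀ R ys s → LevelOK I R s → LevelOK I (sum (map δ ys) + R) (map job ys ++ s)
  levelOK-jobs-++ R []       s ok = ok
  levelOK-jobs-++ R (y ∷ ys) s ok =
    ≤-trans (m≤m+n (δ y) _) (m≤m+n _ R) ,
    subst (λ L → LevelOK I L (map job ys ++ s)) (sym remaining) (levelOK-jobs-++ R ys s ok)
    where
    remaining : δ y + sum (map δ ys) + R ∸ δ y ≡ sum (map δ ys) + R
    remaining = trans (cong (_∸ δ y) (+-assoc (δ y) _ R)) (m+n∸m≡n (δ y) _)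

  levelOK-restoring : ∀ L ys → (∀ y → L + δ y ≤ MLmax) → LevelOK I L (restoring ys)
  levelOK-restoring L []       room = tt
  levelOK-restoring L (y ∷ ys) room =
    room y , m≤n+m (δ y) L , subst (λ L′ → LevelOK I L′ (restoring ys)) (sym (m+n∸n≡m L (δ y))) (levelOK-restoring L ys room)

-- The schedule obtained from X₁

module Reduction (xs : List ℕ) (B M : ℕ) (sel : Selection xs B)
                 (sum-xs : sum xs ≡ 2 * B) (4B≤M : 4 * B ≤ M) where
  open Construction xs B M
  open Selection sel
  open Instance inst using (m; p; δ)

  x ε : ℕ → ℕ
  x = lookupOr 0 xs
  ε = restrictTo chosen x

  not-chosen : n ≤ k → chosen k ≡ false
  not-chosen {k} n≤k with chosen k in e
  ... | false = refl
  ... | true  = contradiction (chosen⇒< k e) (≤⇒≯ n≤k)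

  P-suc : ∀ k → P (suc k) ≡ P k + x k
  P-suc = sum-take-suc xs

  P≤2B : ∀ k → P k ≤ 2 * B
  P≤2B k = subst (P k ≤_) sum-xs (sum-take-≤ xs k)

  P+ε≤2B : ∀ k → P k + ε k ≤ 2 * B
  P+ε≤2B k = ≤-trans (+-monoʳ-≤ (P k) (ε≤x (chosen k))) (subst (_≤ 2 * B) (P-suc k) (P≤2B (suc k)))
    where
    ε≤x : ∀ b → (if b then x k else 0) ≤ x k
    ε≤x true  = ≤-refl
    ε≤x false = z≤n

  double≤M : a ≤ 2 * B → 2 * a ≤ M
  double≤M {a} a≤2B = ≤-trans (*-monoʳ-≤ 2 a≤2B) (subst (_≤ M) (*-assoc 2 2 B) 4B≤M)

  2n+1≡n+1+n : 2 * n + 1 ≡ n + 1 + n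
  2n+1≡n+1+n = identity n
    where
    identity : ∀ n → 2 * n + 1 ≡ n + 1 + n
    identity = solve-∀

  top : ℕ
  top = 2 * n + 2

  upper≤2n+1 : j ≤ n → n + 1 + j ≤ 2 * n + 1
  upper≤2n+1 {j} j≤n = subst (n + 1 + j ≤_) (sym 2n+1≡n+1+n) (+-monoʳ-≤ (n + 1) j≤n)

  lower≤2n+1 : k ≤ n → k ≤ 2 * n + 1
  lower≤2n+1 {k} k≤n = ≤-trans k≤n (subst (n ≤_) (sym 2n+1≡n+1+n) (m≤n+m n (n + 1)))

  2n+1<top : 2 * n + 1 < top
  2n+1<top = subst (2 * n + 1 <_) (+-assoc (2 * n) 1 1) (m<m+n (2 * n + 1) z<s)

  pN-lower : k ≤ n → pN k ≡ P k
  pN-lower = if-≤ᵇ-true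

  pN-upper : j ≤ n → pN (n + 1 + j) ≡ P j
  pN-upper {j} j≤n = begin
    pN (n + 1 + j)
      ≡⟨ if-≤ᵇ-false (<-≤-trans (m<m+n n z<s) (m≤m+n (n + 1) j)) ⟩
    (if n + 1 + j ≤ᵇ 2 * n + 1 then P (n + 1 + j ∸ (n + 1)) else M ∸ 2 * B)
      ≡⟨ if-≤ᵇ-true (upper≤2n+1 j≤n) ⟩
    P (n + 1 + j ∸ (n + 1))
      ≡⟨ cong P (m+n∸m≡n (n + 1) j) ⟩
    P j ∎
    where open ≡-Reasoning

  pN-top : pN top ≡ M ∸ 2 * B
  pN-top = trans (if-≤ᵇ-false (≤-<-trans (lower≤2n+1 ≤-refl) 2n+1<top)) (if-≤ᵇ-false 2n+1<top)

  δN-job : i ≤ 2 * n + 1 → δN i ≡ M ∸ 2 * pN i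
  δN-job = if-≤ᵇ-true

  δN-top : δN top ≡ 0
  δN-top = if-≤ᵇ-false 2n+1<top

  δN-≤ : ∀ i → δN i ≤ M
  δN-≤ i = bound (i ≤ᵇ 2 * n + 1)
    where
    bound : ∀ b → (if b then M ∸ 2 * pN i else 0) ≤ M
    bound true  = m∸n≤m M (2 * pN i)
    bound false = z≤n

  -- For k < n the jobs J_k and J_{high k} = J_{n+2+k} have processing times P k and P (k + 1);
  -- partner swaps their indices exactly when x_{k+1} ∈ X₁ and fixes every other index.
  high : ℕ → ℕ
  high k = n + 1 + suc k

  partner : ℕ → ℕ
  partner i with i ≤? n + 1
  ... | yes _ = if chosen i then high i else i
  ... | no  _ = if chosen (i ∸ (n + 2)) then i ∸ (n + 2) else i

  high≰n+1 : ¬ high k ≤ n + 1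
  high≰n+1 {k} = <⇒≱ (subst (n + 1 <_) (sym (+-suc (n + 1) k)) (s≤s (m≤m+n (n + 1) k)))

  high≡n+2+ : ∀ k → high k ≡ n + 2 + k
  high≡n+2+ k = identity n k
    where
    identity : ∀ n k → n + 1 + suc k ≡ n + 2 + k
    identity = solve-∀

  partner-lower : i ≤ n + 1 → partner i ≡ (if chosen i then high i else i)
  partner-lower {i} i≤n+1 with i ≤? n + 1
  ... | yes _     = refl
  ... | no i≰n+1 = contradiction i≤n+1 i≰n+1

  partner-upper : partner (high k) ≡ (if chosen k then k else high k)
  partner-upper {k} with high k ≤? n + 1
  ... | yes high≤n+1 = contradiction high≤n+1 high≰n+1
  ... | no _          = cong (λ l → if chosen l then l else high k)
                             (trans (cong (_∸ (n + 2)) (high≡n+2+ k)) (m+n∸m≡n (n + 2) k))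

  data Slot : ℕ → Set where
    lower : ∀ {i} → i ≤ n + 1 → Slot i
    upper : ∀ k → Slot (high k)

  slot : ∀ i → Slot i
  slot i with i ≤? n + 1
  ... | yes i≤n+1 = lower i≤n+1
  ... | no  i≰n+1 = subst Slot (trans (high≡n+2+ (i ∸ (n + 2))) (m+[n∸m]≡n n+2≤i)) (upper (i ∸ (n + 2)))
    where
    n+2≤i : n + 2 ≤ i
    n+2≤i = subst (_≤ i) (trans (+-comm 1 (n + 1)) (+-assoc n 1 1)) (≰⇒> i≰n+1)

  chosen⇒≤n+1 : chosen k ≡ true → k ≤ n + 1
  chosen⇒≤n+1 {k} e = ≤-trans (<⇒≤ (chosen⇒< k e)) (m≤m+n n 1)

  partner-involutive : ∀ i → partner (partner i) ≡ i
  partner-involutive i with slot i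
  ... | lower i≤n+1 = trans (cong partner (partner-lower i≤n+1)) (back (chosen i) refl)
    where
    back : ∀ b → chosen i ≡ b → partner (if b then high i else i) ≡ i
    back true  e = trans partner-upper (cong (λ b → if b then i else high i) e)
    back false e = trans (partner-lower i≤n+1) (cong (λ b → if b then high i else i) e)
  ... | upper k = trans (cong partner partner-upper) (back (chosen k) refl)
    where
    back : ∀ b → chosen k ≡ b → partner (if b then k else high k) ≡ high k
    back true  e = trans (partner-lower (chosen⇒≤n+1 e)) (cong (λ b → if b then high k else k) e)
    back false e = trans partner-upper (cong (λ b → if b then k else high k) e)

  partner-≤ : i ≤ 2 * n + 1 → partner i ≤ 2 * n + 1
  partner-≤ {i} i≤2n+1 with slot i
  ... | lower i≤n+1 = subst (_≤ 2 * n + 1) (sym (partner-lower i≤n+1)) (bound (chosen i) refl)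
    where
    bound : ∀ b → chosen i ≡ b → (if b then high i else i) ≤ 2 * n + 1
    bound true  e = upper≤2n+1 (chosen⇒< i e)
    bound false _ = i≤2n+1
  ... | upper k = subst (_≤ 2 * n + 1) (sym partner-upper) (bound (chosen k) refl)
    where
    bound : ∀ b → chosen k ≡ b → (if b then k else high k) ≤ 2 * n + 1
    bound true  e = lower≤2n+1 (<⇒≤ (chosen⇒< k e))
    bound false _ = i≤2n+1

  partner-top : partner top ≡ top
  partner-top = begin
    partner top                          ≡⟨ cong partner high-n ⟨
    partner (high n)                     ≡⟨ partner-upper ⟩
    (if chosen n then n else high n)     ≡⟨ cong (λ b → if b then n else high n) (not-chosen ≤-refl) ⟩
    high n                               ≡⟨ high-n ⟩
    top                                  ∎
    where
    open ≡-Reasoning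
    high-n : high n ≡ top
    high-n = identity n
      where
      identity : ∀ n → n + 1 + suc n ≡ 2 * n + 2
      identity = solve-∀

  m≡suc[2n+2] : m ≡ suc top
  m≡suc[2n+2] = +-suc (2 * n) 2

  top≡suc[2n+1] : top ≡ suc (2 * n + 1)
  top≡suc[2n+1] = +-suc (2 * n) 1

  top<m : top < m
  top<m = subst (top <_) (sym m≡suc[2n+2]) ≤-refl

  ≤2n+1⇒<m : i ≤ 2 * n + 1 → i < m
  ≤2n+1⇒<m {i} i≤2n+1 = <-trans (subst (i <_) (sym top≡suc[2n+1]) (s≤s i≤2n+1)) top<m

  partner-<m : i < m → partner i < m
  partner-<m {i} i<m with m≤n⇒m<n∨m≡n (≤-pred (subst (i <_) m≡suc[2n+2] i<m))
  ... | inj₁ i<top  = ≤2n+1⇒<m (partner-≤ (≤-pred (subst (i <_) top≡suc[2n+1] i<top)))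
  ... | inj₂ refl   = subst (_< m) (sym partner-top) top<m

  instance
    m-nonZero : NonZero m
    m-nonZero = >-nonZero (≤-trans (s≤s z≤n) top<m)

  -- Only applied to indices below m, where it is the identity (toℕ-J).
  J : ℕ → Fin m
  J i = i mod m

  toℕ-J : i < m → toℕ (J i) ≡ i
  toℕ-J i<m = trans (toℕ-fromℕ< _) (m<n⇒m%n≡m i<m)

  first<m : k < suc n → partner k < m
  first<m k<1+n = ≤2n+1⇒<m (partner-≤ (lower≤2n+1 (≤-pred k<1+n)))

  second<m : j < suc n → partner (n + 1 + j) < m
  second<m j<1+n = ≤2n+1⇒<m (partner-≤ (upper≤2n+1 (≤-pred j<1+n)))

  firstHalf secondHalf : List (Fin m)
  firstHalf  = applyUpTo (J ∘ partner) (suc n)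
  secondHalf = applyDownFrom (λ j → J (partner (n + 1 + j))) (suc n)

  schedule : Schedule m
  schedule = map job firstHalf ++ job (J top) ∷ restoring inst secondHalf

  P≤M : ∀ k → P k ≤ M
  P≤M k = ≤-trans (m≤m+n (P k) (P k + 0)) (double≤M (P≤2B k))

  δN+pN : ∀ j → i ≤ 2 * n + 1 → pN i ≡ P j → δN i + pN i ≡ M ∸ P j
  δN+pN {i} j i≤2n+1 pN≡P = begin
    δN i + pN i                ≡⟨ cong (_+ pN i) (δN-job i≤2n+1) ⟩
    (M ∸ 2 * pN i) + pN i      ≡⟨ cong (λ v → (M ∸ 2 * v) + v) pN≡P ⟩
    (M ∸ 2 * P j) + P j        ≡⟨ cong (λ v → (M ∸ v) + P j) double ⟩
    (M ∸ (P j + P j)) + P j    ≡⟨ ∸-+-cancelʳ (P j) (P j) (subst (_≤ M) double (double≤M (P≤2B j))) ⟩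
    M ∸ P j                    ∎
    where
    open ≡-Reasoning
    double : 2 * P j ≡ P j + P j
    double = cong (P j +_) (+-identityʳ (P j))

  pN-first : k ≤ n → pN (partner k) ≡ P k + ε k
  pN-first {k} k≤n = trans (cong pN (partner-lower (≤-trans k≤n (m≤m+n n 1)))) (by-choice (chosen k) refl)
    where
    by-choice : ∀ b → chosen k ≡ b → pN (if b then high k else k) ≡ P k + (if b then x k else 0)
    by-choice true  e = trans (pN-upper (chosen⇒< k e)) (P-suc k)
    by-choice false _ = trans (pN-lower k≤n) (sym (+-identityʳ (P k)))

  ε₂ : ℕ → ℕ
  ε₂ zero    = 0
  ε₂ (suc k) = ε k

  δN+pN-second : j ≤ n → δN (partner (n + 1 + j)) + pN (partner (n + 1 + j)) ≡ (M ∸ P j) + ε₂ j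
  δN+pN-second {zero} _ = begin
    δN (partner (n + 1 + 0)) + pN (partner (n + 1 + 0))
      ≡⟨ cong (λ i → δN i + pN i) partner-fixed ⟩
    δN (n + 1 + 0) + pN (n + 1 + 0)
      ≡⟨ δN+pN 0 (upper≤2n+1 z≤n) (pN-upper z≤n) ⟩
    M ∸ P 0
      ≡⟨ +-identityʳ _ ⟨
    (M ∸ P 0) + 0 ∎
    where
    open ≡-Reasoning
    partner-fixed : partner (n + 1 + 0) ≡ n + 1 + 0
    partner-fixed = trans (partner-lower (≤-reflexive (+-identityʳ (n + 1))))
                          (cong (λ b → if b then high (n + 1 + 0) else n + 1 + 0)
                                (not-chosen (≤-trans (m≤m+n n 1) (m≤m+n (n + 1) 0))))
  δN+pN-second {suc k} 1+k≤n =
    trans (cong (λ i → δN i + pN i) partner-upper) (by-choice (chosen k) refl)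
    where
    k≤n : k ≤ n
    k≤n = <⇒≤ 1+k≤n
    by-choice : ∀ b → chosen k ≡ b → δN (if b then k else high k) + pN (if b then k else high k) ≡ (M ∸ P (suc k)) + (if b then x k else 0)
    by-choice true _ = begin
      δN k + pN k                 ≡⟨ δN+pN k (lower≤2n+1 k≤n) (pN-lower k≤n) ⟩
      M ∸ P k                     ≡⟨ ∸-+-cancelʳ (P k) (x k) (subst (_≤ M) (P-suc k) (P≤M (suc k))) ⟨
      (M ∸ (P k + x k)) + x k     ≡⟨ cong (λ v → (M ∸ v) + x k) (P-suc k) ⟨
      (M ∸ P (suc k)) + x k       ∎
      where open ≡-Reasoning
    by-choice false _ = trans (δN+pN (suc k) (upper≤2n+1 1+k≤n) (pN-upper 1+k≤n)) (sym (+-identityʳ _))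

  module _ (j : Fin m) where
    private
      hit : Fin m → ℕ
      hit = indicator (toℕ j) ∘ toℕ
      partnerHit : ℕ → ℕ
      partnerHit k = indicator (toℕ j) (partner k)

    sum-hit-first : sum (map hit firstHalf) ≡ sum (applyUpTo partnerHit (suc n))
    sum-hit-first = cong sum (trans (map-applyUpTo (J ∘ partner) hit (suc n))
                                    (applyUpTo-cong (λ k<1+n → cong (indicator (toℕ j)) (toℕ-J (first<m k<1+n)))))

    sum-hit-second : sum (map hit secondHalf) ≡ sum (applyUpTo (λ i → partnerHit (suc n + i)) (suc n))
    sum-hit-second = begin
      sum (map hit secondHalf)
        ≡⟨ cong sum (map-applyDownFrom (λ i → J (partner (n + 1 + i))) hit (suc n)) ⟩
      sum (applyDownFrom (λ i → hit (J (partner (n + 1 + i)))) (suc n))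
        ≡⟨ cong sum (applyDownFrom-cong (λ i<1+n → cong (indicator (toℕ j)) (toℕ-J (second<m i<1+n)))) ⟩
      sum (applyDownFrom (λ i → partnerHit (n + 1 + i)) (suc n))
        ≡⟨ sum-applyDownFrom (suc n) ⟩
      sum (applyUpTo (λ i → partnerHit (n + 1 + i)) (suc n))
        ≡⟨ cong sum (applyUpTo-cong {c = suc n} (λ {i} _ → cong (λ l → partnerHit (l + i)) (+-comm n 1))) ⟩
      sum (applyUpTo (λ i → partnerHit (suc n + i)) (suc n)) ∎
      where open ≡-Reasoning

    hit-top : hit (J top) ≡ partnerHit (suc n + suc n)
    hit-top = cong (indicator (toℕ j)) (trans (toℕ-J top<m) (trans (sym partner-top) (cong partner top≡)))
      where
      top≡ : top ≡ suc n + suc n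
      top≡ = identity n
        where
        identity : ∀ n → 2 * n + 2 ≡ suc n + suc n
        identity = solve-∀

    occ-schedule : occ inst j schedule ≡ 1
    occ-schedule = begin
      occ inst j schedule
        ≡⟨ occ-jobs-++ inst j firstHalf _ ⟩
      sum (map hit firstHalf) + occ inst j (job (J top) ∷ restoring inst secondHalf)
        ≡⟨ cong (sum (map hit firstHalf) +_) (occ-job-∷ inst j (J top) _) ⟩
      sum (map hit firstHalf) + (hit (J top) + occ inst j (restoring inst secondHalf))
        ≡⟨ cong (λ o → sum (map hit firstHalf) + (hit (J top) + o)) (occ-restoring inst j secondHalf) ⟩
      sum (map hit firstHalf) + (hit (J top) + sum (map hit secondHalf))
        ≡⟨ cong₂ _+_ sum-hit-first (trans (+-comm (hit (J top)) (sum (map hit secondHalf))) (cong₂ _+_ sum-hit-second hit-top)) ⟩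
      sum (applyUpTo partnerHit (suc n)) + (sum (applyUpTo (λ i → partnerHit (suc n + i)) (suc n)) + partnerHit (suc n + suc n))
        ≡⟨ cong (sum (applyUpTo partnerHit (suc n)) +_) (sum-applyUpTo-∷ʳ {λ i → partnerHit (suc n + i)} (suc n)) ⟨
      sum (applyUpTo partnerHit (suc n)) + sum (applyUpTo (λ i → partnerHit (suc n + i)) (suc (suc n)))
        ≡⟨ sum-applyUpTo-+ {partnerHit} (suc n) (suc (suc n)) ⟨
      sum (applyUpTo partnerHit (suc n + suc (suc n)))
        ≡⟨ cong (λ l → sum (applyUpTo partnerHit l)) m≡ ⟨
      sum (applyUpTo partnerHit m)
        ≡⟨ sum-applyUpTo-indicator-involution partner partner-involutive (toℕ j) (partner-<m (toℕ<n j)) ⟩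
      1 ∎
      where
      open ≡-Reasoning
      m≡ : m ≡ suc n + suc (suc n)
      m≡ = identity n
        where
        identity : ∀ n → 2 * n + 3 ≡ suc n + suc (suc n)
        identity = solve-∀

  sum-ε : sum (applyUpTo ε (suc n)) ≡ B
  sum-ε = begin
    sum (applyUpTo ε (suc n))     ≡⟨ sum-applyUpTo-∷ʳ {ε} n ⟩
    sum (applyUpTo ε n) + ε n     ≡⟨ cong₂ _+_ sum-chosen (cong (λ b → if b then x n else 0) (not-chosen ≤-refl)) ⟩
    B + 0                         ≡⟨ +-identityʳ B ⟩
    B                             ∎
    where open ≡-Reasoning

  δN-split : k ≤ n → δN k ≡ δN (partner k) + (ε k + ε k)
  δN-split {k} k≤n = begin
    δN k                                                   ≡⟨ δN-job (lower≤2n+1 k≤n) ⟩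
    M ∸ 2 * pN k                                           ≡⟨ cong (λ v → M ∸ 2 * v) (pN-lower k≤n) ⟩
    M ∸ 2 * P k                                            ≡⟨ ∸-+-cancelʳ (2 * P k) (ε k + ε k) (subst (_≤ M) (sym distrib) (double≤M (P+ε≤2B k))) ⟨
    (M ∸ (2 * P k + (ε k + ε k))) + (ε k + ε k)            ≡⟨ cong (λ v → (M ∸ v) + (ε k + ε k)) distrib ⟩
    (M ∸ 2 * (P k + ε k)) + (ε k + ε k)                    ≡⟨ cong (λ v → (M ∸ 2 * v) + (ε k + ε k)) (pN-first k≤n) ⟨
    (M ∸ 2 * pN (partner k)) + (ε k + ε k)                 ≡⟨ cong (_+ (ε k + ε k)) (δN-job (partner-≤ (lower≤2n+1 k≤n))) ⟨
    δN (partner k) + (ε k + ε k)                           ∎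
    where
    open ≡-Reasoning
    distrib : 2 * P k + (ε k + ε k) ≡ 2 * (P k + ε k)
    distrib = identity (P k) (ε k)
      where
      identity : ∀ a e → 2 * a + (e + e) ≡ 2 * (a + e)
      identity = solve-∀

  ML₀≡ : ML₀ ≡ sum (map δ firstHalf) + 0
  ML₀≡ = begin
    MLmax ∸ 2 * B                       ≡⟨ cong (_∸ 2 * B) MLmax≡ ⟩
    sum (map δ firstHalf) + 2 * B ∸ 2 * B ≡⟨ m+n∸n≡m _ (2 * B) ⟩
    sum (map δ firstHalf)               ≡⟨ +-identityʳ _ ⟨
    sum (map δ firstHalf) + 0           ∎
    where
    open ≡-Reasoning
    δ-first : map δ firstHalf ≡ applyUpTo (δN ∘ partner) (suc n)
    δ-first = trans (map-applyUpTo (J ∘ partner) δ (suc n)) (applyUpTo-cong (λ k<1+n → cong δN (toℕ-J (first<m k<1+n))))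
    MLmax≡ : MLmax ≡ sum (map δ firstHalf) + 2 * B
    MLmax≡ = begin
      sumTo n δN                                                      ≡⟨ sumTo-applyUpTo n δN ⟩
      sum (applyUpTo δN (suc n))                                      ≡⟨ cong sum (applyUpTo-cong (δN-split ∘ ≤-pred)) ⟩
      sum (applyUpTo (λ k → δN (partner k) + (ε k + ε k)) (suc n))
        ≡⟨ sum-applyUpTo-pointwise (δN ∘ partner) (λ k → ε k + ε k) (suc n) ⟩
      sum (applyUpTo (δN ∘ partner) (suc n)) + sum (applyUpTo (λ k → ε k + ε k) (suc n))
        ≡⟨ cong (sum (applyUpTo (δN ∘ partner) (suc n)) +_) (sum-applyUpTo-pointwise ε ε (suc n)) ⟩
      sum (applyUpTo (δN ∘ partner) (suc n)) + (sum (applyUpTo ε (suc n)) + sum (applyUpTo ε (suc n)))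
        ≡⟨ cong₂ (λ a b → a + (b + b)) (cong sum (sym δ-first)) sum-ε ⟩
      sum (map δ firstHalf) + (B + B)                                 ≡⟨ cong (λ b → sum (map δ firstHalf) + (B + b)) (+-identityʳ B) ⟨
      sum (map δ firstHalf) + 2 * B                                   ∎

  levels-schedule : LevelOK inst ML₀ schedule
  levels-schedule = subst (λ L → LevelOK inst L schedule) (sym ML₀≡) (levelOK-jobs-++ inst 0 firstHalf _ (top-ok , rest-ok))
    where
    δ-top : δ (J top) ≡ 0
    δ-top = trans (cong δN (toℕ-J top<m)) δN-top
    top-ok : δ (J top) ≤ 0
    top-ok = ≤-reflexive δ-top
    rest-ok : LevelOK inst (0 ∸ δ (J top)) (restoring inst secondHalf)
    rest-ok = subst (λ L → LevelOK inst L (restoring inst secondHalf)) (cong (0 ∸_) (sym δ-top))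
                    (levelOK-restoring inst 0 secondHalf (λ y → ≤-trans (δN-≤ (toℕ y)) (sumTo-≥-first n δN)))

  p-first : map p firstHalf ≡ applyUpTo (λ k → P k + ε k) (suc n)
  p-first = trans (map-applyUpTo (J ∘ partner) p (suc n))
                  (applyUpTo-cong (λ k<1+n → trans (cong pN (toℕ-J (first<m k<1+n))) (pN-first (≤-pred k<1+n))))

  δ+p-second : map (λ y → δ y + p y) secondHalf ≡ applyDownFrom (λ j → (M ∸ P j) + ε₂ j) (suc n)
  δ+p-second = trans (map-applyDownFrom (λ j → J (partner (n + 1 + j))) (λ y → δ y + p y) (suc n))
                     (applyDownFrom-cong (λ j<1+n → trans (cong (λ i → δN i + pN i) (toℕ-J (second<m j<1+n)))
                                                          (δN+pN-second (≤-pred j<1+n))))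

  extra-cost : totalCompletion 0 (applyUpTo ε (suc n)) + totalCompletion 0 (applyDownFrom ε₂ (suc n)) ≡ suc n * B + (B + B)
  extra-cost = begin
    totalCompletion 0 (applyUpTo ε (suc n)) + totalCompletion 0 (applyDownFrom ε₂ (suc n))
      ≡⟨ cong₂ (λ u d → totalCompletion 0 u + totalCompletion 0 d) (applyUpTo-∷ʳ ε n) (applyDownFrom-∷ʳ ε₂ n) ⟨
    totalCompletion 0 (applyUpTo ε n ∷ʳ ε n) + totalCompletion 0 (applyDownFrom ε n ∷ʳ 0)
      ≡⟨ cong₂ _+_ (totalCompletion-∷ʳ 0 (applyUpTo ε n) (ε n)) (totalCompletion-∷ʳ 0 (applyDownFrom ε n) 0) ⟩
    (U + (S + ε n)) + (D + (sum (applyDownFrom ε n) + 0))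
      ≡⟨ cong₂ (λ e s → (U + (S + e)) + (D + (s + 0))) (cong (λ b → if b then x n else 0) (not-chosen ≤-refl)) (sum-applyDownFrom n) ⟩
    (U + (S + 0)) + (D + (S + 0))
      ≡⟨ regroup U D S ⟩
    (U + D) + (S + S)
      ≡⟨ cong (_+ (S + S)) (totalCompletion-applyUpTo+applyDownFrom n ε) ⟩
    suc n * S + (S + S)
      ≡⟨ cong (λ s → suc n * s + (s + s)) sum-chosen ⟩
    suc n * B + (B + B) ∎
    where
    open ≡-Reasoning
    U D S : ℕ
    U = totalCompletion 0 (applyUpTo ε n)
    D = totalCompletion 0 (applyDownFrom ε n)
    S = sum (applyUpTo ε n)
    regroup : ∀ U D S → (U + (S + 0)) + (D + (S + 0)) ≡ (U + D) + (S + S)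
    regroup = solve-∀

  module Cost where
    CP Cε₁ ΣP CM Cε₂ T : ℕ
    CP  = totalCompletion 0 (applyUpTo P (suc n))
    Cε₁ = totalCompletion 0 (applyUpTo ε (suc n))
    ΣP = sum (applyUpTo P (suc n))
    CM = totalCompletion 0 (applyDownFrom (λ j → M ∸ P j) (suc n))
    Cε₂ = totalCompletion 0 (applyDownFrom ε₂ (suc n))
    T  = ΣP + B + pN top

    Q≡ : Q ≡ ((CP + (n + 2) * (ΣP + 2 * B + pN top)) + CM) + B
    Q≡ = cong (_+ B) (cong₂ _+_ (cong₂ (λ a s → a + (n + 2) * (s + 2 * B + pN top)) weighted-P sum-P) weighted-upper)
      where
      weighted-P : sumTo n (λ j → (n ∸ j + 1) * pN j) ≡ CP
      weighted-P = trans (sumTo-cong n (λ {j} j≤n → cong ((n ∸ j + 1) *_) (pN-lower j≤n))) (sym (totalCompletion-applyUpTo n P))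
      sum-P : sumTo n pN ≡ ΣP
      sum-P = trans (sumTo-cong n pN-lower) (sumTo-applyUpTo n P)
      weighted-upper : sumTo n (λ j → (j + 1) * (pN (n + 1 + j) + δN (n + 1 + j))) ≡ CM
      weighted-upper = trans (sumTo-cong n (λ {j} j≤n → cong ((j + 1) *_) (trans (+-comm (pN (n + 1 + j)) (δN (n + 1 + j))) (δN+pN j (upper≤2n+1 j≤n) (pN-upper j≤n)))))
                             (sym (totalCompletion-applyDownFrom n (λ j → M ∸ P j)))

    first-cost : totalCompletion 0 (map p firstHalf) ≡ CP + Cε₁
    first-cost = trans (cong (totalCompletion 0) p-first) (totalCompletion-applyUpTo-+ {0} {0} {P} {ε} (suc n))

    start-of-top : sum (map p firstHalf) + p (J top) ≡ T
    start-of-top = cong₂ _+_ duration (cong pN (toℕ-J top<m))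
      where
      duration : sum (map p firstHalf) ≡ ΣP + B
      duration = trans (cong sum p-first) (trans (sum-applyUpTo-pointwise P ε (suc n)) (cong (ΣP +_) sum-ε))

    second-cost : tct inst T (restoring inst secondHalf) ≡ suc n * T + (CM + Cε₂)
    second-cost = begin
      tct inst T (restoring inst secondHalf)
        ≡⟨ tct-restoring inst T secondHalf ⟩
      totalCompletion T (map (λ y → δ y + p y) secondHalf)
        ≡⟨ cong (totalCompletion T) δ+p-second ⟩
      totalCompletion T (applyDownFrom (λ j → (M ∸ P j) + ε₂ j) (suc n))
        ≡⟨ totalCompletion-shift T (applyDownFrom (λ j → (M ∸ P j) + ε₂ j) (suc n)) ⟩
      length (applyDownFrom (λ j → (M ∸ P j) + ε₂ j) (suc n)) * T + totalCompletion 0 (applyDownFrom (λ j → (M ∸ P j) + ε₂ j) (suc n))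
        ≡⟨ cong₂ (λ l c → l * T + c) (length-applyDownFrom (λ j → (M ∸ P j) + ε₂ j) (suc n)) (totalCompletion-applyDownFrom-+ {0} {0} {λ j → M ∸ P j} {ε₂} (suc n)) ⟩
      suc n * T + (CM + Cε₂) ∎
      where open ≡-Reasoning

    cost-schedule : TotalCompletionTime inst schedule ≡ Q
    cost-schedule = begin
      tct inst 0 schedule
        ≡⟨ tct-jobs-++ inst 0 firstHalf _ ⟩
      totalCompletion 0 (map p firstHalf) + (T₀ + tct inst T₀ (restoring inst secondHalf))
        ≡⟨ cong₂ (λ a t → a + (t + tct inst t (restoring inst secondHalf))) first-cost start-of-top ⟩
      (CP + Cε₁) + (T + tct inst T (restoring inst secondHalf))
        ≡⟨ cong (λ c → (CP + Cε₁) + (T + c)) second-cost ⟩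
      (CP + Cε₁) + (T + (suc n * T + (CM + Cε₂)))
        ≡⟨ regroup CP Cε₁ Cε₂ CM T n ⟩
      (CP + CM + (2 + n) * T) + (Cε₁ + Cε₂)
        ≡⟨ cong (CP + CM + (2 + n) * T +_) extra-cost ⟩
      (CP + CM + (2 + n) * T) + (suc n * B + (B + B))
        ≡⟨ collect CP CM ΣP B (pN top) n ⟩
      ((CP + (n + 2) * (ΣP + 2 * B + pN top)) + CM) + B
        ≡⟨ Q≡ ⟨
      Q ∎
      where
      open ≡-Reasoning
      T₀ : ℕ
      T₀ = sum (map p firstHalf) + p (J top)
      regroup : ∀ CP Cε₁ Cε₂ CM T n → (CP + Cε₁) + (T + (suc n * T + (CM + Cε₂))) ≡ (CP + CM + (2 + n) * T) + (Cε₁ + Cε₂)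
      regroup = solve-∀
      collect : ∀ CP CM ΣP B pT n → (CP + CM + (2 + n) * (ΣP + B + pT)) + (suc n * B + (B + B)) ≡ ((CP + (n + 2) * (ΣP + 2 * B + pT)) + CM) + B
      collect = solve-∀

4*B≤M : ∀ n B M → (4 * n + 8) * B < M → 4 * B ≤ M
4*B≤M n B M size = ≤-trans (m≤m+n (4 * B) ((4 * n + 4) * B)) (≤-trans (≤-reflexive (split n B)) (<⇒≤ size))
  where
  split : ∀ n B → 4 * B + (4 * n + 4) * B ≡ (4 * n + 8) * B
  split = solve-∀

theorem4 : (xs : List ℕ) (B M : ℕ)
    → All (λ x → 0 < x) xs
    → sum xs ≡ 2 * B
    → (4 * Construction.n xs B M + 8) * B < M
    → Σ (List ℕ) (λ X₁ → X₁ ⊆ xs × sum X₁ ≡ B)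
    → Σ (Schedule (Instance.m (Construction.inst xs B M))) (λ s →
        Feasible (Construction.inst xs B M) s
        × TotalCompletionTime (Construction.inst xs B M) s ≤ Construction.Q xs B M)
theorem4 xs B M _ sum-xs size (X₁ , X₁⊆xs , sum-X₁) =
  schedule , (occ-schedule , levels-schedule) , ≤-reflexive cost-schedule
  where
  open Reduction xs B M (subst (Selection xs) sum-X₁ (sublist-selection X₁⊆xs)) sum-xs (4*B≤M (length xs) B M size)
  open Cost
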